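{- Let $n>1$ be an integer and $r,t,t'\in\mathbb{Z}$ with $\gcd(r,n)=1$ and $\gcd(t,n)=\gcd(t',n)$. Then $\mathsf{c}(V_n, a_{n,r,t})=\mathsf{c}(V_n, a_{n,r,t'})$.
   Context: $\mathrm{D}_{2n}=\langle u_n,v_n\mid u_n^n=v_n^2=1,\ v_nu_nv_n=u_n^{ -1}\rangle$; $a_{n,r,t}$ is the automorphism $u_n^i\mapsto u_n^{ri}$, $u_n^jv_n\mapsto u_n^{rj+t}v_n$. $V_n=\{u_n^iv_n\mid 0\le i\le n-1\}$. $\mathsf{c}(V_n,a)$ is the number of cycles (including fixed points) of the permutation induced by $a$ on $V_n$. -}

module Defs where

open import Data.Nat as ℕ using (ℕ; zero; suc; NonZero)
open import Data.Nat.Properties using (_≤?_)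
open import Data.Integer as ℤ using (ℤ; +_)
open import Data.Integer.DivMod using (_%_; n%d<d)
open import Data.Fin using (Fin; toℕ; fromℕ<)
open import Data.List using (List; length; filter; upTo; allFin)
open import Data.List.Relation.Unary.All using (All; all?)
open import Relation.Nullary using (Dec)

-- V_n = { u_n^i v_n | 0 ≤ i ≤ n-1 } is indexed by Fin n : index i stands for u_n^i v_n.

-- The permutation of V_n induced by a_{n,r,t} : u_n^j v_n ↦ u_n^{rj+t} v_n,
-- i.e. on exponents  j ↦ (r j + t) mod n.
aV : (n : ℕ) .{{_ : NonZero n}} → ℤ → ℤ → Fin n → Fin n
aV n r t j = fromℕ< (n%d<d (r ℤ.* (+ toℕ j) ℤ.+ t) (+ n))

iter : {A : Set} → (A → A) → ℕ → A → A
iter f zero    x = x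
iter f (suc k) x = f (iter f k x)

-- i is the least element (by index) of its cycle under f : Fin n → Fin n
-- (the cycle of i is { f^k i | k < n }, since cycles have length ≤ n).
IsCycleMin : (n : ℕ) → (Fin n → Fin n) → Fin n → Set
IsCycleMin n f i = All (λ k → toℕ i ℕ.≤ toℕ (iter f k i)) (upTo n)

isCycleMin? : (n : ℕ) → (f : Fin n → Fin n) → (i : Fin n) → Dec (IsCycleMin n f i)
isCycleMin? n f i = all? (λ k → toℕ i ≤? toℕ (iter f k i)) (upTo n)


-- number of cycles (including fixed points) of a permutation f of Fin n:
-- each cycle is counted once, via its least element.
cycles : (n : ℕ) → (Fin n → Fin n) → ℕ
cycles n f = length (filter (isCycleMin? n f) (allFin n))

cV : (n : ℕ) .{{_ : NonZero n}} → ℤ → ℤ → ℕ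
cV n r t = cycles n (aV n r t)

{-# OPTIONS --safe #-}
-- Let d = gcd(t, n) = gcd(t′, n) and m = n / d, so that t = a d and t′ = b d with a, b coprime to m.
-- Solve w a ≡ b (mod m) and lift w to u = w + c m, where c is the largest divisor of n coprime to w:
-- u is a unit modulo n and u t ≡ t′ (mod n). Multiplication by u then conjugates j ↦ r j + t into
-- j ↦ r j + t′, and conjugate permutations have equally many cycles.
module Submission where

open import Defs
open import Data.Nat as ℕ
  using (ℕ; zero; suc; _≤_; _<_; s≤s; z≤n; NonZero; >-nonZero; ≢-nonZero; ≢-nonZero⁻¹; >-nonZero⁻¹)
open import Data.Nat.Properties
  using (≤-trans; ≤-antisym; ≤-reflexive; ≤-<-trans; ≤∧≢⇒<; <-trans; n<1+n; m≤n+m; m≤n⇒∃[o]m+o≡n;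
         ⊔-lub; +-suc; +-comm; *-suc; *-comm)
open import Data.Nat.DivMod using (m≡m%n+[m/n]*n; m%n<n; m/n<m; m*[n/m]≡n; m/n*n≡m; /-congʳ)
open import Data.Nat.Divisibility using (_∣_; >⇒∤; ∣-trans; ∣-refl; ∣m+n∣m⇒∣n; ∣m⇒∣m*n; m∣m*n)
import Data.Nat.GCD as ℕ using (gcd)
open import Data.Nat.GCD using (gcd[m,n]∣m; gcd[m,n]∣n; gcd[m,n]≢0; m/gcd[m,n]≢0; n/gcd[m,n]≢0; module Bézout)
open import Data.Nat.Coprimality
  using (Coprime; coprime?; coprime-divisor; coprime-Bézout; coprime-/gcd; gcd≡1⇒coprime; 1-coprimeTo)
  renaming (sym to coprime-sym)
open import Data.Nat.Induction using (<-wellFounded)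
open import Data.Integer as ℤ using (ℤ; +_; -[1+_]; ∣_∣; 0ℤ; 1ℤ; -1ℤ)
open import Data.Integer.Properties
  using (+-inverseʳ; *-assoc; *-identityˡ; *-identityʳ; -1*i≡-i; +-injective; pos-+; pos-*; abs-*;
         i-j≡0⇒i≡j; ∣i∣≡0⇒i≡0; [+m]-[+n]≡m⊖n; ∣m⊝n∣≤m⊔n)
import Data.Integer.Properties as ℤ using (*-comm)
open import Data.Integer.DivMod using (a≡a%n+[a/n]*n)
open import Data.Integer.GCD using (gcd)
import Data.Integer.Divisibility.Signed as ℤ
import Data.Integer.Coprimality as ℤ using (coprime-divisor)
open import Data.Integer.Tactic.RingSolver using (solve-∀)
open import Data.Fin using (Fin; toℕ)
open import Data.Fin.Properties using (toℕ-injective; toℕ<n; toℕ≤pred[n]; toℕ-fromℕ<; pigeonhole)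
open import Data.List using (List; []; _∷_; length; _++_; filter; allFin; upTo)
open import Data.List.Extrema.Nat using (argmin; f[argmin]≤f[xs])
open import Data.List.Membership.Propositional using (_∈_)
open import Data.List.Membership.Propositional.Properties
  using (∈-∃++; ∈-++⁻; ∈-++⁺ˡ; ∈-++⁺ʳ; ∈-filter⁺; ∈-filter⁻; ∈-allFin; ∈-upTo⁺)
open import Data.List.Properties using (length-++-sucʳ)
open import Data.List.Relation.Unary.All as All using (All)
open import Data.List.Relation.Unary.All.Properties using (applyUpTo⁺₁)
open import Data.List.Relation.Unary.Any using (here; there)
open import Data.List.Relation.Unary.AllPairs using (_∷_)
open import Data.List.Relation.Unary.Unique.Propositional using (Unique)
open import Data.List.Relation.Unary.Unique.Propositional.Properties using (filter⁺; allFin⁺)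
open import Data.Product using (∃-syntax; _×_; _,_; proj₁; proj₂)
open import Data.Sum using (inj₁; inj₂)
open import Function using (id; _∘_; Injective)
open import Induction.WellFounded using (Acc; acc)
open import Relation.Binary.Bundles using (Setoid)
open import Relation.Binary.Structures using (IsEquivalence)
import Relation.Binary.Reasoning.Setoid as ≈-Reasoning
open import Relation.Nullary using (¬_; yes; no; contradiction)
open import Relation.Binary.PropositionalEquality

injection⇒length≤ : ∀ {A B : Set} (h : A → B) {xs : List A} {ys : List B} → Unique xs →
                    (∀ {x} → x ∈ xs → h x ∈ ys) →
                    (∀ {x y} → x ∈ xs → y ∈ xs → h x ≡ h y → x ≡ y) →
                    length xs ≤ length ys
injection⇒length≤ h {[]}     _               _    _   = z≤n
injection⇒length≤ h {x ∷ xs} (x∉xs ∷ unique) into inj with ∈-∃++ (into (here refl))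
... | ys₁ , ys₂ , refl =
  subst (suc (length xs) ≤_) (sym (length-++-sucʳ ys₁ (h x) ys₂))
        (s≤s (injection⇒length≤ h unique into′ λ p q → inj (there p) (there q)))
  where
  into′ : ∀ {y} → y ∈ xs → h y ∈ ys₁ ++ ys₂
  into′ {y} y∈xs with ∈-++⁻ ys₁ (into (there y∈xs))
  ... | inj₁ p         = ∈-++⁺ˡ p
  ... | inj₂ (here eq) = contradiction (sym (inj (there y∈xs) (here refl) eq)) (All.lookup x∉xs y∈xs)
  ... | inj₂ (there p) = ∈-++⁺ʳ ys₁ p

module _ {A : Set} (f : A → A) where

  open import Data.Nat using (_+_; _*_; _%_; _/_)
  open ≡-Reasoning

  iter-+ : ∀ m n x → iter f (m + n) x ≡ iter f m (iter f n x)
  iter-+ zero    n x = refl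
  iter-+ (suc m) n x = cong f (iter-+ m n x)

  iter-injective : Injective _≡_ _≡_ f → ∀ k → Injective _≡_ _≡_ (iter f k)
  iter-injective f-inj zero    eq = eq
  iter-injective f-inj (suc k) eq = iter-injective f-inj k (f-inj eq)

  iter-*-period : ∀ {p x} → iter f p x ≡ x → ∀ k → iter f (k * p) x ≡ x
  iter-*-period fᵖx≡x zero              = refl
  iter-*-period {p} {x} fᵖx≡x (suc k) = begin
    iter f (p + k * p) x        ≡⟨ iter-+ p (k * p) x ⟩
    iter f p (iter f (k * p) x) ≡⟨ cong (iter f p) (iter-*-period fᵖx≡x k) ⟩
    iter f p x                  ≡⟨ fᵖx≡x ⟩
    x                           ∎

  iter-%-period : ∀ {p x} .{{_ : NonZero p}} → iter f p x ≡ x → ∀ c → iter f c x ≡ iter f (c % p) x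
  iter-%-period {p} {x} fᵖx≡x c = begin
    iter f c x                            ≡⟨ cong (λ k → iter f k x) (m≡m%n+[m/n]*n c p) ⟩
    iter f (c % p + c / p * p) x          ≡⟨ iter-+ (c % p) (c / p * p) x ⟩
    iter f (c % p) (iter f (c / p * p) x) ≡⟨ cong (iter f (c % p)) (iter-*-period fᵖx≡x (c / p)) ⟩
    iter f (c % p) x                      ∎

  -- Going a more times around the cycle of x, of length 1 + q, undoes the a steps.
  periodic⇒reachable : ∀ {q x y} → iter f (suc q) x ≡ x → ∀ a b → iter f a x ≡ iter f b y →
                       x ≡ iter f (a * q + b) y
  periodic⇒reachable {q} {x} {y} fˢᵘᶜᑫx≡x a b fᵃx≡fᵇy = begin
    x                           ≡⟨ sym (iter-*-period fˢᵘᶜᑫx≡x a) ⟩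
    iter f (a * suc q) x        ≡⟨ cong (λ k → iter f k x) (trans (*-suc a q) (+-comm a (a * q))) ⟩
    iter f (a * q + a) x        ≡⟨ iter-+ (a * q) a x ⟩
    iter f (a * q) (iter f a x) ≡⟨ cong (iter f (a * q)) fᵃx≡fᵇy ⟩
    iter f (a * q) (iter f b y) ≡⟨ sym (iter-+ (a * q) b y) ⟩
    iter f (a * q + b) y        ∎

iter-conjugate : ∀ {A B : Set} (f : A → A) (f′ : B → B) (g : A → B) →
                 (∀ x → g (f x) ≡ f′ (g x)) → ∀ k x → g (iter f k x) ≡ iter f′ k (g x)
iter-conjugate f f′ g g∘f≗f′∘g zero    x = refl
iter-conjugate f f′ g g∘f≗f′∘g (suc k) x =
  trans (g∘f≗f′∘g (iter f k x)) (cong f′ (iter-conjugate f f′ g g∘f≗f′∘g k x))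

module Orbits {n : ℕ} (f : Fin n → Fin n) (f-injective : Injective _≡_ _≡_ f) where

  open import Data.Nat using (_+_; _*_; _%_)
  open ≡-Reasoning

  periodic : ∀ x → ∃[ q ] q < n × iter f (suc q) x ≡ x
  periodic x with i , j , i<j , fⁱx≡fʲx ← pigeonhole (n<1+n n) (λ k → iter f (toℕ k) x)
             with q , i+1+q≡j ← m≤n⇒∃[o]m+o≡n i<j =
    q , ≤-trans (s≤s (m≤n+m q (toℕ i))) (≤-trans (≤-reflexive i+1+q≡j) (toℕ≤pred[n] j)) ,
    iter-injective f f-injective (toℕ i) (begin
      iter f (toℕ i) (iter f (suc q) x) ≡⟨ sym (iter-+ f (toℕ i) (suc q) x) ⟩
      iter f (toℕ i + suc q) x          ≡⟨ cong (λ k → iter f k x) (trans (+-suc (toℕ i) q) i+1+q≡j) ⟩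
      iter f (toℕ j) x                  ≡⟨ fⁱx≡fʲx ⟨
      iter f (toℕ i) x                  ∎)

  orbit-bounded : ∀ x c → ∃[ c′ ] c′ < n × iter f c x ≡ iter f c′ x
  orbit-bounded x c with q , q<n , fˢᵘᶜᑫx≡x ← periodic x =
    c % suc q , ≤-trans (m%n<n c (suc q)) q<n , iter-%-period f fˢᵘᶜᑫx≡x c

  cycleMin-≤ : ∀ {x y} → IsCycleMin n f x → ∀ c → y ≡ iter f c x → toℕ x ≤ toℕ y
  cycleMin-≤ {x} x-min c refl with c′ , c′<n , fᶜx≡fᶜ′x ← orbit-bounded x c =
    subst (λ z → toℕ x ≤ toℕ z) (sym fᶜx≡fᶜ′x) (All.lookup x-min (∈-upTo⁺ c′<n))

  cycleMin-unique : ∀ {x y} → IsCycleMin n f x → IsCycleMin n f y →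
                    ∀ a b → iter f a x ≡ iter f b y → x ≡ y
  cycleMin-unique {x} {y} x-min y-min a b fᵃx≡fᵇy
    with qx , _ , x-periodic ← periodic x | qy , _ , y-periodic ← periodic y =
    toℕ-injective (≤-antisym
      (cycleMin-≤ x-min (b * qy + a) (periodic⇒reachable f y-periodic b a (sym fᵃx≡fᵇy)))
      (cycleMin-≤ y-min (a * qx + b) (periodic⇒reachable f x-periodic a b fᵃx≡fᵇy)))

  minStep : Fin n → ℕ
  minStep x = argmin (λ k → toℕ (iter f k x)) 0 (upTo n)

  orbitMin : Fin n → Fin n
  orbitMin x = iter f (minStep x) x

  orbitMin-isCycleMin : ∀ x → IsCycleMin n f (orbitMin x)
  orbitMin-isCycleMin x = applyUpTo⁺₁ id n λ {l} _ → orbitMin-≤ l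
    where
    orbitMin-≤ : ∀ l → toℕ (orbitMin x) ≤ toℕ (iter f l (orbitMin x))
    orbitMin-≤ l with c′ , c′<n , eq ← orbit-bounded x (l + minStep x) =
      subst (λ z → toℕ (orbitMin x) ≤ toℕ z) (trans (sym eq) (iter-+ f l (minStep x) x))
            (All.lookup (f[argmin]≤f[xs] 0 (upTo n)) (∈-upTo⁺ c′<n))

-- Each cycle of f, represented by its least element x, goes to the cycle of f′ through g x.
cycles-conjugate-≤ : ∀ {n} {f f′ g : Fin n → Fin n} →
                     Injective _≡_ _≡_ f → Injective _≡_ _≡_ f′ → Injective _≡_ _≡_ g →
                     (∀ x → g (f x) ≡ f′ (g x)) → cycles n f ≤ cycles n f′
cycles-conjugate-≤ {n} {f} {f′} {g} f-inj f′-inj g-inj g∘f≗f′∘g =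
  injection⇒length≤ (O′.orbitMin ∘ g) (filter⁺ (isCycleMin? n f) (allFin⁺ n))
    (λ _ → ∈-filter⁺ (isCycleMin? n f′) (∈-allFin _) (O′.orbitMin-isCycleMin _))
    λ {x} {y} x∈ y∈ → O.cycleMin-unique (cycleMin x∈) (cycleMin y∈)
                        (O′.minStep (g x)) (O′.minStep (g y)) ∘ g-inj ∘ via-g
  where
  module O  = Orbits f f-inj
  module O′ = Orbits f′ f′-inj
  open ≡-Reasoning
  cycleMin : ∀ {x} → x ∈ filter (isCycleMin? n f) (allFin n) → IsCycleMin n f x
  cycleMin = proj₂ ∘ ∈-filter⁻ (isCycleMin? n f) {xs = allFin n}
  via-g : ∀ {x y} → O′.orbitMin (g x) ≡ O′.orbitMin (g y) →
          g (iter f (O′.minStep (g x)) x) ≡ g (iter f (O′.minStep (g y)) y)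
  via-g {x} {y} eq = begin
    g (iter f (O′.minStep (g x)) x) ≡⟨ iter-conjugate f f′ g g∘f≗f′∘g (O′.minStep (g x)) x ⟩
    O′.orbitMin (g x)               ≡⟨ eq ⟩
    O′.orbitMin (g y)               ≡⟨ iter-conjugate f f′ g g∘f≗f′∘g (O′.minStep (g y)) y ⟨
    g (iter f (O′.minStep (g y)) y) ∎

m<n∧n∣m⇒m≡0 : ∀ {m n} → m < n → n ∣ m → m ≡ 0
m<n∧n∣m⇒m≡0 {zero}  _   _   = refl
m<n∧n∣m⇒m≡0 {suc _} m<n n∣m = contradiction n∣m (>⇒∤ m<n)

coprime-∣ˡ : ∀ {d m n} → d ∣ m → Coprime m n → Coprime d n
coprime-∣ˡ d∣m m⊥n (e∣d , e∣n) = m⊥n (∣-trans e∣d d∣m , e∣n)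

coprime-* : ∀ {a b n} → Coprime a n → Coprime b n → Coprime (a ℕ.* b) n
coprime-* a⊥n b⊥n (d∣ab , d∣n) =
  b⊥n (coprime-divisor (coprime-∣ˡ d∣n (coprime-sym a⊥n)) d∣ab , d∣n)

divide-out-gcd : ∀ c w .{{_ : NonZero c}} → ¬ Coprime c w →
                 ∃[ c₁ ] NonZero c₁ × c₁ < c × (∀ {q} → q ∣ c → Coprime q w → q ∣ c₁)
divide-out-gcd c w ¬c⊥w = c ℕ./ g , ≢-nonZero (m/gcd[m,n]≢0 c w) , m/n<m c g 1<g , q∣c/g
  where
  g : ℕ
  g = ℕ.gcd c w
  instance
    g≢0 : NonZero g
    g≢0 = ≢-nonZero (gcd[m,n]≢0 c w (inj₁ (≢-nonZero⁻¹ c)))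
  1<g : 1 < g
  1<g = ≤∧≢⇒< (>-nonZero⁻¹ g) (≢-sym (¬c⊥w ∘ gcd≡1⇒coprime))
  q∣c/g : ∀ {q} → q ∣ c → Coprime q w → q ∣ c ℕ./ g
  q∣c/g q∣c q⊥w = coprime-divisor (coprime-sym (coprime-∣ˡ (gcd[m,n]∣n c w) (coprime-sym q⊥w)))
                                  (subst (_ ∣_) (sym (m*[n/m]≡n (gcd[m,n]∣m c w))) q∣c)

coprimePart : ∀ w c .{{_ : NonZero c}} →
              ∃[ c′ ] Coprime c′ w × (∀ {q} → q ∣ c → Coprime q w → q ∣ c′)
coprimePart w c = go c (<-wellFounded c)
  where
  go : ∀ c → Acc _<_ c → .{{_ : NonZero c}} →
       ∃[ c′ ] Coprime c′ w × (∀ {q} → q ∣ c → Coprime q w → q ∣ c′)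
  go c (acc rec) with coprime? c w
  ... | yes c⊥w = c , c⊥w , λ q∣c _ → q∣c
  ... | no ¬c⊥w with c₁ , c₁≢0 , c₁<c , q∣c₁ ← divide-out-gcd c w ¬c⊥w
                with c′ , c′⊥w , q∣c′ ← go c₁ (rec c₁<c) {{c₁≢0}} =
    c′ , c′⊥w , λ q∣c q⊥w → q∣c′ (q∣c₁ q∣c q⊥w) q⊥w

-- A common divisor q of w + c m and n is coprime to w (a common divisor of q and w divides c, as
-- w ⊥ m, while c ⊥ w); so q divides c, hence w, and q = 1.
coprime-lift : ∀ {w m} n .{{_ : NonZero n}} → Coprime w m → ∃[ c ] Coprime (w ℕ.+ c ℕ.* m) n
coprime-lift {w} {m} n w⊥m with c , c⊥w , q∣c ← coprimePart w n = c , u⊥n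
  where
  u⊥n : Coprime (w ℕ.+ c ℕ.* m) n
  u⊥n {q} (q∣u , q∣n) = q⊥w (∣-refl , q∣w)
    where
    q⊥w : Coprime q w
    q⊥w {s} (s∣q , s∣w) = c⊥w (s∣c , s∣w)
      where
      s∣cm : s ∣ c ℕ.* m
      s∣cm = ∣m+n∣m⇒∣n (∣-trans s∣q q∣u) s∣w
      s∣c : s ∣ c
      s∣c = coprime-divisor (coprime-∣ˡ s∣w w⊥m) (subst (s ∣_) (*-comm c m) s∣cm)
    q∣w : q ∣ w
    q∣w = ∣m+n∣m⇒∣n (subst (q ∣_) (+-comm w (c ℕ.* m)) q∣u) (∣m⇒∣m*n m (q∣c q∣n q⊥w))

infix 4 _≡_mod_
-- A record rather than an abbreviation of n ∣ x - y, so that x and y are recoverable by unification.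
record _≡_mod_ (x y : ℤ) (n : ℕ) : Set where
  constructor congruent
  field divides-difference : + n ℤ.∣ x ℤ.- y

Associated : ℕ → ℤ → ℤ → Set
Associated n x y = ∃[ u ] Coprime ∣ u ∣ n × u ℤ.* x ≡ y mod n

module _ {n : ℕ} where

  open import Data.Integer using (_+_; _*_; _-_; -_; _%_; _/_)

  ≡-mod-reflexive : ∀ {x y} → x ≡ y → x ≡ y mod n
  ≡-mod-reflexive {x} refl = congruent (ℤ.divides 0ℤ (+-inverseʳ x))

  ≡-mod-sym : ∀ {x y} → x ≡ y mod n → y ≡ x mod n
  ≡-mod-sym {x} {y} (congruent n∣x-y) =
    congruent (subst (+ n ℤ.∣_) (neg-minus x y) (ℤ.∣m⇒∣-m n∣x-y))
    where
    neg-minus : ∀ x y → - (x - y) ≡ y - x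
    neg-minus = solve-∀

  ≡-mod-trans : ∀ {x y z} → x ≡ y mod n → y ≡ z mod n → x ≡ z mod n
  ≡-mod-trans {x} {y} {z} (congruent n∣x-y) (congruent n∣y-z) =
    congruent (subst (+ n ℤ.∣_) (telescope x y z) (ℤ.∣m∣n⇒∣m+n n∣x-y n∣y-z))
    where
    telescope : ∀ x y z → (x - y) + (y - z) ≡ x - z
    telescope = solve-∀

  ≡-mod-isEquivalence : IsEquivalence (_≡_mod n)
  ≡-mod-isEquivalence = record
    { refl = ≡-mod-reflexive refl ; sym = ≡-mod-sym ; trans = ≡-mod-trans }

  ≡-mod-setoid : Setoid _ _
  ≡-mod-setoid = record { isEquivalence = ≡-mod-isEquivalence }

  *-scale-mod : ∀ d {x y} → x ≡ y mod n → x * + d ≡ y * + d mod (n ℕ.* d)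
  *-scale-mod d {x} {y} (congruent (ℤ.divides q x-y≡qn)) = congruent (ℤ.divides q (begin
    x * + d - y * + d ≡⟨ factor x y (+ d) ⟩
    (x - y) * + d     ≡⟨ cong (_* + d) x-y≡qn ⟩
    q * + n * + d     ≡⟨ *-assoc q (+ n) (+ d) ⟩
    q * (+ n * + d)   ≡⟨ cong (q *_) (pos-* n d) ⟨
    q * + (n ℕ.* d)   ∎))
    where
    open ≡-Reasoning
    factor : ∀ x y d → x * d - y * d ≡ (x - y) * d
    factor = solve-∀

  open ≈-Reasoning ≡-mod-setoid

  +-cong-mod : ∀ {x x′ y y′} → x ≡ x′ mod n → y ≡ y′ mod n → x + y ≡ x′ + y′ mod n
  +-cong-mod {x} {x′} {y} {y′} (congruent n∣x-x′) (congruent n∣y-y′) =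
    congruent (subst (+ n ℤ.∣_) (regroup x x′ y y′) (ℤ.∣m∣n⇒∣m+n n∣x-x′ n∣y-y′))
    where
    regroup : ∀ x x′ y y′ → (x - x′) + (y - y′) ≡ (x + y) - (x′ + y′)
    regroup = solve-∀

  +-congˡ-mod : ∀ z {y y′} → y ≡ y′ mod n → z + y ≡ z + y′ mod n
  +-congˡ-mod z = +-cong-mod (≡-mod-reflexive {z} refl)

  +-congʳ-mod : ∀ z {x x′} → x ≡ x′ mod n → x + z ≡ x′ + z mod n
  +-congʳ-mod z x≡x′ = +-cong-mod x≡x′ (≡-mod-reflexive {z} refl)

  +-cancelʳ-mod : ∀ z {x x′} → x + z ≡ x′ + z mod n → x ≡ x′ mod n
  +-cancelʳ-mod z {x} {x′} (congruent n∣[x+z]-[x′+z]) =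
    congruent (subst (+ n ℤ.∣_) (cancel x x′ z) n∣[x+z]-[x′+z])
    where
    cancel : ∀ x x′ z → (x + z) - (x′ + z) ≡ x - x′
    cancel = solve-∀

  *-congˡ-mod : ∀ z {x x′} → x ≡ x′ mod n → z * x ≡ z * x′ mod n
  *-congˡ-mod z {x} {x′} (congruent n∣x-x′) =
    congruent (subst (+ n ℤ.∣_) (distrib z x x′) (ℤ.∣n⇒∣m*n z n∣x-x′))
    where
    distrib : ∀ z x x′ → z * (x - x′) ≡ z * x - z * x′
    distrib = solve-∀

  *-congʳ-mod : ∀ z {x x′} → x ≡ x′ mod n → x * z ≡ x′ * z mod n
  *-congʳ-mod z {x} {x′} x≡x′ = subst₂ (_≡_mod n) (ℤ.*-comm z x) (ℤ.*-comm z x′) (*-congˡ-mod z x≡x′)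

  *-cancelˡ-mod : ∀ z {x x′} → Coprime ∣ z ∣ n → z * x ≡ z * x′ mod n → x ≡ x′ mod n
  *-cancelˡ-mod z {x} {x′} z⊥n (congruent n∣zx-zx′) = congruent (ℤ.∣ᵤ⇒∣
    (ℤ.coprime-divisor (+ n) z (x - x′) (coprime-sym z⊥n)
      (ℤ.∣⇒∣ᵤ (subst (+ n ℤ.∣_) (factor z x x′) n∣zx-zx′))))
    where
    factor : ∀ z x x′ → z * x - z * x′ ≡ z * (x - x′)
    factor = solve-∀

  +-multiple-mod : ∀ x k → x + k * + n ≡ x mod n
  +-multiple-mod x k = congruent (ℤ.divides k (cancel x k (+ n)))
    where
    cancel : ∀ x k n → (x + k * n) - x ≡ k * n
    cancel = solve-∀

  %-≡-mod : ∀ x .{{_ : NonZero n}} → + (x % + n) ≡ x mod n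
  %-≡-mod x = begin
    + (x % + n)                 ≈⟨ +-multiple-mod (+ (x % + n)) (x / + n) ⟨
    + (x % + n) + x / + n * + n ≡⟨ a≡a%n+[a/n]*n x (+ n) ⟨
    x                           ∎

  ≡-mod⇒≡ : ∀ {i j} → i < n → j < n → + i ≡ + j mod n → i ≡ j
  ≡-mod⇒≡ {i} {j} i<n j<n (congruent n∣i-j) =
    +-injective (i-j≡0⇒i≡j (+ i) (+ j) (∣i∣≡0⇒i≡0 (m<n∧n∣m⇒m≡0 ∣i-j∣<n (ℤ.∣⇒∣ᵤ n∣i-j))))
    where
    ∣i-j∣<n : ∣ + i - + j ∣ < n
    ∣i-j∣<n = subst (_< n) (cong ∣_∣ (sym ([+m]-[+n]≡m⊖n i j)))
                    (≤-<-trans (∣m⊝n∣≤m⊔n i j) (⊔-lub i<n j<n))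

  toℕ-≡-mod⇒≡ : ∀ {i j : Fin n} → + toℕ i ≡ + toℕ j mod n → i ≡ j
  toℕ-≡-mod⇒≡ {i} {j} = toℕ-injective ∘ ≡-mod⇒≡ (toℕ<n i) (toℕ<n j)

  ≡-mod-coprime : ∀ {x y} → x ≡ y mod n → Coprime ∣ y ∣ n → Coprime ∣ x ∣ n
  ≡-mod-coprime {x} {y} (congruent n∣x-y) y⊥n {e} (e∣x , e∣n) = y⊥n (ℤ.∣⇒∣ᵤ e∣y , e∣n)
    where
    cancel : ∀ x y → x - (x - y) ≡ y
    cancel = solve-∀
    e∣y : + e ℤ.∣ y
    e∣y = subst (+ e ℤ.∣_) (cancel x y)
                (ℤ.∣m∣n⇒∣m-n (ℤ.∣ᵤ⇒∣ {+ e} {x} e∣x) (ℤ.∣-trans (ℤ.∣ᵤ⇒∣ {+ e} {+ n} e∣n) n∣x-y))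

  *-≡-mod-coprime : ∀ {x y z} → x * y ≡ z mod n → Coprime ∣ z ∣ n → Coprime ∣ x ∣ n
  *-≡-mod-coprime {x} {y} xy≡z z⊥n =
    coprime-∣ˡ (subst (∣ x ∣ ∣_) (sym (abs-* x y)) (m∣m*n ∣ y ∣)) (≡-mod-coprime xy≡z z⊥n)

  coprime⇒invertible : ∀ {a} → Coprime a n → ∃[ x ] x * + a ≡ 1ℤ mod n
  coprime⇒invertible {a} a⊥n with coprime-Bézout a⊥n
  ... | Bézout.+- x y 1+yn≡xa = + x , (begin
    + x * + a         ≡⟨ pos-* x a ⟨
    + (x ℕ.* a)       ≡⟨ cong +_ 1+yn≡xa ⟨
    + (1 ℕ.+ y ℕ.* n) ≡⟨ cong (λ k → 1ℤ + k) (pos-* y n) ⟩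
    1ℤ + + y * + n    ≈⟨ +-multiple-mod 1ℤ (+ y) ⟩
    1ℤ                ∎)
  ... | Bézout.-+ x y 1+xa≡yn = - + x , (begin
    - + x * + a            ≡⟨ move (+ x) (+ a) ⟩
    1ℤ - (1ℤ + + x * + a)  ≡⟨ cong (λ k → 1ℤ - (1ℤ + k)) (pos-* x a) ⟨
    1ℤ - + (1 ℕ.+ x ℕ.* a) ≡⟨ cong (λ k → 1ℤ - + k) 1+xa≡yn ⟩
    1ℤ - + (y ℕ.* n)       ≡⟨ cong (λ k → 1ℤ - k) (pos-* y n) ⟩
    1ℤ - + y * + n         ≡⟨ negate (+ y) (+ n) ⟩
    1ℤ + - + y * + n       ≈⟨ +-multiple-mod 1ℤ (- + y) ⟩
    1ℤ                     ∎)
    where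
    move : ∀ x a → - x * a ≡ 1ℤ - (1ℤ + x * a)
    move = solve-∀
    negate : ∀ y n → 1ℤ - y * n ≡ 1ℤ + - y * n
    negate = solve-∀

  coprime⇒linear-solvable : ∀ {a} → Coprime a n → ∀ y → ∃[ w ] w * + a ≡ y mod n
  coprime⇒linear-solvable {a} a⊥n y with a⁻¹ , a⁻¹a≡1 ← coprime⇒invertible a⊥n = y * a⁻¹ , (begin
    y * a⁻¹ * + a   ≡⟨ *-assoc y a⁻¹ (+ a) ⟩
    y * (a⁻¹ * + a) ≈⟨ *-congˡ-mod y a⁻¹a≡1 ⟩
    y * 1ℤ          ≡⟨ *-identityʳ y ⟩
    y               ∎)

  coprime-lift-mod : ∀ {w} N .{{_ : NonZero n}} .{{_ : NonZero N}} →
                     Coprime ∣ w ∣ n → ∃[ u ] Coprime ∣ u ∣ N × u ≡ w mod n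
  coprime-lift-mod {w} N w⊥n with c , u⊥N ← coprime-lift N (≡-mod-coprime (%-≡-mod w) w⊥n) =
    + (w % + n ℕ.+ c ℕ.* n) , u⊥N , (begin
      + (w % + n ℕ.+ c ℕ.* n)   ≡⟨ pos-+ (w % + n) (c ℕ.* n) ⟩
      + (w % + n) + + (c ℕ.* n) ≡⟨ cong (λ k → + (w % + n) + k) (pos-* c n) ⟩
      + (w % + n) + + c * + n   ≈⟨ +-multiple-mod (+ (w % + n)) (+ c) ⟩
      + (w % + n)               ≈⟨ %-≡-mod w ⟩
      w                         ∎)

  coprime⇒unit-solution : ∀ {a b} N .{{_ : NonZero n}} .{{_ : NonZero N}} →
                          Coprime a n → Coprime b n → ∃[ u ] Coprime ∣ u ∣ N × u * + a ≡ + b mod n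
  coprime⇒unit-solution {a} {b} N a⊥n b⊥n = u , u⊥N , ≡-mod-trans (*-congʳ-mod (+ a) u≡w) wa≡b
    where
    solution : ∃[ w ] w * + a ≡ + b mod n
    solution = coprime⇒linear-solvable a⊥n (+ b)
    w : ℤ
    w = proj₁ solution
    wa≡b : w * + a ≡ + b mod n
    wa≡b = proj₂ solution
    lift : ∃[ u ] Coprime ∣ u ∣ N × u ≡ w mod n
    lift = coprime-lift-mod {w = w} N (*-≡-mod-coprime {w} {+ a} wa≡b b⊥n)
    u : ℤ
    u = proj₁ lift
    u⊥N : Coprime ∣ u ∣ N
    u⊥N = proj₁ (proj₂ lift)
    u≡w : u ≡ w mod n
    u≡w = proj₂ (proj₂ lift)

  Associated-trans : ∀ {x y z} → Associated n x y → Associated n y z → Associated n x z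
  Associated-trans {x} {y} {z} (u , u⊥n , ux≡y) (v , v⊥n , vy≡z) =
    v * u , subst (λ k → Coprime k n) (sym (abs-* v u)) (coprime-* v⊥n u⊥n) , (begin
      v * u * x   ≡⟨ *-assoc v u x ⟩
      v * (u * x) ≈⟨ *-congˡ-mod v ux≡y ⟩
      v * y       ≈⟨ vy≡z ⟩
      z           ∎)

  Associated-abs : ∀ x → Associated n x (+ ∣ x ∣)
  Associated-abs (+ k)    = 1ℤ , 1-coprimeTo n , ≡-mod-reflexive (*-identityˡ (+ k))
  Associated-abs -[1+ k ] = -1ℤ , 1-coprimeTo n , ≡-mod-reflexive (-1*i≡-i -[1+ k ])

  Associated-abs⁻ : ∀ x → Associated n (+ ∣ x ∣) x
  Associated-abs⁻ (+ k)    = 1ℤ , 1-coprimeTo n , ≡-mod-reflexive (*-identityˡ (+ k))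
  Associated-abs⁻ -[1+ k ] = -1ℤ , 1-coprimeTo n , ≡-mod-reflexive (-1*i≡-i (+ suc k))

module _ (n : ℕ) .{{_ : NonZero n}} where

  open import Data.Integer using (_+_; _*_)
  open ≈-Reasoning (≡-mod-setoid {n})

  aV-≡-mod : ∀ r t j → + toℕ (aV n r t j) ≡ r * + toℕ j + t mod n
  aV-≡-mod r t j = subst (λ k → + k ≡ r * + toℕ j + t mod n) (sym (toℕ-fromℕ< _))
                         (%-≡-mod (r * + toℕ j + t))

  aV-injective : ∀ r t → Coprime ∣ r ∣ n → Injective _≡_ _≡_ (aV n r t)
  aV-injective r t r⊥n {i} {j} aVi≡aVj = toℕ-≡-mod⇒≡ (*-cancelˡ-mod r r⊥n (+-cancelʳ-mod t (begin
    r * + toℕ i + t    ≈⟨ aV-≡-mod r t i ⟨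
    + toℕ (aV n r t i) ≡⟨ cong (+_ ∘ toℕ) aVi≡aVj ⟩
    + toℕ (aV n r t j) ≈⟨ aV-≡-mod r t j ⟩
    r * + toℕ j + t    ∎)))

  aV-conjugate : ∀ {r t t′ u} → u * t ≡ t′ mod n →
                 ∀ j → aV n u 0ℤ (aV n r t j) ≡ aV n r t′ (aV n u 0ℤ j)
  aV-conjugate {r} {t} {t′} {u} ut≡t′ j = toℕ-≡-mod⇒≡ (begin
    + toℕ (aV n u 0ℤ (aV n r t j)) ≈⟨ aV-≡-mod u 0ℤ (aV n r t j) ⟩
    u * + toℕ (aV n r t j) + 0ℤ    ≈⟨ +-congʳ-mod 0ℤ (*-congˡ-mod u (aV-≡-mod r t j)) ⟩
    u * (r * j′ + t) + 0ℤ          ≡⟨ regroup u r j′ t ⟩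
    r * (u * j′ + 0ℤ) + u * t      ≈⟨ +-congˡ-mod (r * (u * j′ + 0ℤ)) ut≡t′ ⟩
    r * (u * j′ + 0ℤ) + t′         ≈⟨ +-congʳ-mod t′ (*-congˡ-mod r (aV-≡-mod u 0ℤ j)) ⟨
    r * + toℕ (aV n u 0ℤ j) + t′   ≈⟨ aV-≡-mod r t′ (aV n u 0ℤ j) ⟨
    + toℕ (aV n r t′ (aV n u 0ℤ j)) ∎)
    where
    j′ : ℤ
    j′ = + toℕ j
    regroup : ∀ u r j t → u * (r * j + t) + 0ℤ ≡ r * (u * j + 0ℤ) + u * t
    regroup = solve-∀

  cV-≤-associated : ∀ r s s′ → Coprime ∣ r ∣ n → Associated n s s′ → cV n r s ≤ cV n r s′
  cV-≤-associated r s s′ r⊥n (u , u⊥n , us≡s′) =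
    cycles-conjugate-≤ (aV-injective r s r⊥n) (aV-injective r s′ r⊥n) (aV-injective u 0ℤ u⊥n)
                       (aV-conjugate {r} {s} {s′} {u} us≡s′)

module _ {n : ℕ} .{{_ : NonZero n}} where

  open import Data.Integer using (_*_)
  open ≈-Reasoning (≡-mod-setoid {n})

  gcdℕ≡⇒associated : ∀ {A B} → ℕ.gcd A n ≡ ℕ.gcd B n → Associated n (+ A) (+ B)
  gcdℕ≡⇒associated {A} {B} gcdA≡gcdB = u , u⊥n , (begin
    u * + A         ≡⟨ cong (λ k → u * + k) A≡ad ⟩
    u * + (a ℕ.* d) ≡⟨ cong (u *_) (pos-* a d) ⟩
    u * (+ a * + d) ≡⟨ *-assoc u (+ a) (+ d) ⟨
    u * + a * + d   ≈⟨ subst (u * + a * + d ≡ + b * + d mod_) md≡n (*-scale-mod d ua≡b) ⟩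
    + b * + d       ≡⟨ pos-* b d ⟨
    + (b ℕ.* d)     ≡⟨ cong +_ bd≡B ⟩
    + B             ∎)
    where
    d : ℕ
    d = ℕ.gcd A n
    instance
      d≢0 : NonZero d
      d≢0 = ≢-nonZero (gcd[m,n]≢0 A n (inj₂ (≢-nonZero⁻¹ n)))
      gcd[B,n]≢0 : NonZero (ℕ.gcd B n)
      gcd[B,n]≢0 = ≢-nonZero (gcd[m,n]≢0 B n (inj₂ (≢-nonZero⁻¹ n)))
    a b m : ℕ
    a = A ℕ./ d
    b = B ℕ./ d
    m = n ℕ./ d
    instance
      m≢0 : NonZero m
      m≢0 = ≢-nonZero (n/gcd[m,n]≢0 A n)
    A≡ad : A ≡ a ℕ.* d
    A≡ad = sym (m/n*n≡m (gcd[m,n]∣m A n))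
    bd≡B : b ℕ.* d ≡ B
    bd≡B = m/n*n≡m (subst (_∣ B) (sym gcdA≡gcdB) (gcd[m,n]∣m B n))
    md≡n : m ℕ.* d ≡ n
    md≡n = m/n*n≡m (gcd[m,n]∣n A n)
    a⊥m : Coprime a m
    a⊥m = coprime-/gcd A n
    b⊥m : Coprime b m
    b⊥m = subst₂ Coprime (/-congʳ (sym gcdA≡gcdB)) (/-congʳ (sym gcdA≡gcdB)) (coprime-/gcd B n)
    unit-solution : ∃[ u ] Coprime ∣ u ∣ n × u * + a ≡ + b mod m
    unit-solution = coprime⇒unit-solution n a⊥m b⊥m
    u : ℤ
    u = proj₁ unit-solution
    u⊥n : Coprime ∣ u ∣ n
    u⊥n = proj₁ (proj₂ unit-solution)
    ua≡b : u * + a ≡ + b mod m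
    ua≡b = proj₂ (proj₂ unit-solution)

  gcd≡⇒associated : ∀ {t t′} → gcd t (+ n) ≡ gcd t′ (+ n) → Associated n t t′
  gcd≡⇒associated {t} {t′} gcd≡ =
    Associated-trans (Associated-abs t)
      (Associated-trans (gcdℕ≡⇒associated {∣ t ∣} {∣ t′ ∣} (+-injective gcd≡)) (Associated-abs⁻ t′))

lemma4p2 : (n : ℕ) (1<n : 1 < n) (r t t′ : ℤ) →
           gcd r (+ n) ≡ + 1 → gcd t (+ n) ≡ gcd t′ (+ n) →
           cV n {{>-nonZero (<-trans (s≤s z≤n) 1<n)}} r t
             ≡ cV n {{>-nonZero (<-trans (s≤s z≤n) 1<n)}} r t′
lemma4p2 n 1<n r t t′ gcd[r,n]≡1 gcd[t,n]≡gcd[t′,n] =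
  ≤-antisym (cV-≤-associated n r t t′ r⊥n (gcd≡⇒associated {t = t} {t′} gcd[t,n]≡gcd[t′,n]))
            (cV-≤-associated n r t′ t r⊥n (gcd≡⇒associated {t = t′} {t} (sym gcd[t,n]≡gcd[t′,n])))
  where
  instance
    n≢0 : NonZero n
    n≢0 = >-nonZero (<-trans (s≤s z≤n) 1<n)
  r⊥n : Coprime ∣ r ∣ n
  r⊥n = gcd≡1⇒coprime (+-injective gcd[r,n]≡1)
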